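{- Let $a,\dots,b\in A$ be agents. For all $\psi,\chi_a,\dots,\chi_b\in\mathcal{L}_{EL}$ and every $\varphi\in\mathcal{L}_{CoGAL}$, the formula $$[\psi\wedge K_a t([\psi]\chi_a)\wedge\dots\wedge K_b t([\psi]\chi_b)]\varphi\leftrightarrow[\psi][K_a\chi_a\wedge\dots\wedge K_b\chi_b]\varphi$$ is valid.
   Context: Fix a finite set of agents $A$ and a countable set $P$ of propositional variables. The language $\mathcal{L}_{CoGAL}$ is given by $\varphi ::= p \mid \neg\varphi \mid (\varphi\wedge\varphi) \mid K_a\varphi \mid [\varphi]\varphi \mid [G]\varphi \mid [\!\langle G\rangle\!]\varphi$ with $p\in P$, $a\in A$, $G\subseteq A$; usual propositional abbreviations. $\mathcal{L}_{EL}$ is the fragment built from $p,\neg,\wedge,K_a$; $\mathcal{L}_{PAL}$ is the fragment built from $p,\neg,\wedge,K_a,[\varphi]\psi$. For $G\subseteq A$, $\mathcal{L}_{EL}^G$ is the set of formulas $\bigwedge_{i\in G}K_i\varphi_i$ with each $\varphi_i\in\mathcal{L}_{EL}$. An epistemic model is $M=(W,\sim,V)$ with $W\neq\emptyset$, $\sim_a$ an equivalence relation on $W$ for each $a$, $V:P\to\mathcal P(W)$. Semantics at $(M,w)$: $p$ iff $w\in V(p)$; Boolean clauses as usual; $K_a\varphi$ iff $(M,v)\models\varphi$ for all $v$ with $w\sim_a v$; $[\varphi]\psi$ iff $(M,w)\models\varphi$ implies $(M^\varphi,w)\models\psi$, where $M^\varphi$ is the restriction of $M$ to $\llbracket\varphi\rrbracket_M=\{v:(M,v)\models\varphi\}$;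 $[G]\varphi$ iff for all $\psi\in\mathcal{L}_{EL}^G$, $(M,w)\models[\psi]\varphi$; $[\!\langle G\rangle\!]\varphi$ iff for all $\psi\in\mathcal{L}_{EL}^G$ there is $\chi\in\mathcal{L}_{EL}^{A\setminus G}$ with $(M,w)\models\psi\to\neg[\psi\wedge\chi]\neg\varphi$. A formula is valid if true at every pointed model. The translation $t:\mathcal{L}_{PAL}\to\mathcal{L}_{EL}$ is defined by $t(p)=p$, $t(\neg\varphi)=\neg t(\varphi)$, $t(\varphi\wedge\psi)=t(\varphi)\wedge t(\psi)$, $t(K_a\varphi)=K_at(\varphi)$, $t([\varphi]p)=t(\varphi\to p)$, $t([\varphi]\neg\psi)=t(\varphi\to\neg[\varphi]\psi)$, $t([\varphi](\psi\wedge\chi))=t([\varphi]\psi\wedge[\varphi]\chi)$, $t([\varphi]K_a\psi)=t(\varphi\to K_a[\varphi]\psi)$, $t([\varphi][\psi]\chi)=t([\varphi\wedge[\varphi]\psi]\chi)$. -}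

module Defs where

open import Data.Nat using (ℕ; zero; suc; _+_; _*_; _⊔_)
open import Data.Fin using (Fin)
open import Data.Fin.Subset using (Subset; ∁)
open import Data.Bool using (Bool; T)
open import Data.Vec using (lookup)
open import Data.List using (List; []; _∷_; map; filter; allFin)
open import Data.List.NonEmpty as L⁺ using (List⁺; _∷_)
open import Data.Product using (Σ; _×_; _,_)
open import Relation.Nullary using (¬_)
open import Relation.Nullary.Decidable.Core using (T?)
open import Relation.Binary using (IsEquivalence)

Agent : ℕ → Set
Agent n = Fin n

Prop : Set
Prop = ℕ

data EL (n : ℕ) : Set where
  atom : Prop → EL n
  neg  : EL n → EL n
  and  : EL n → EL n → EL n
  K    : Agent n → EL n → EL n

data PAL (n : ℕ) : Set where
  atom : Prop → PAL n
  neg  : PAL n → PAL n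
  and  : PAL n → PAL n → PAL n
  K    : Agent n → PAL n → PAL n
  ann  : PAL n → PAL n → PAL n

data Form (n : ℕ) : Set where
  atom : Prop → Form n
  neg  : Form n → Form n
  and  : Form n → Form n → Form n
  K    : Agent n → Form n → Form n
  ann  : Form n → Form n → Form n
  grp  : Subset n → Form n → Form n
  coal : Subset n → Form n → Form n

elToPAL : ∀ {n} → EL n → PAL n
elToPAL (atom p)  = atom p
elToPAL (neg φ)   = neg (elToPAL φ)
elToPAL (and φ ψ) = and (elToPAL φ) (elToPAL ψ)
elToPAL (K a φ)   = K a (elToPAL φ)

elToForm : ∀ {n} → EL n → Form n
elToForm (atom p)  = atom p
elToForm (neg φ)   = neg (elToForm φ)
elToForm (and φ ψ) = and (elToForm φ) (elToForm ψ)
elToForm (K a φ)   = K a (elToForm φ)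

⊤EL : ∀ {n} → EL n
⊤EL = neg (and (atom 0) (neg (atom 0)))

_⇒P_ : ∀ {n} → PAL n → PAL n → PAL n
φ ⇒P ψ = neg (and φ (neg ψ))

_⇒F_ : ∀ {n} → Form n → Form n → Form n
φ ⇒F ψ = neg (and φ (neg ψ))

_⇔F_ : ∀ {n} → Form n → Form n → Form n
φ ⇔F ψ = and (φ ⇒F ψ) (ψ ⇒F φ)

⋀ : ∀ {n} → List (EL n) → EL n
⋀ []           = ⊤EL
⋀ (φ ∷ [])     = φ
⋀ (φ ∷ ψ ∷ ψs) = and φ (⋀ (ψ ∷ ψs))

⋀⁺ : ∀ {n} → List⁺ (EL n) → EL n
⋀⁺ (φ ∷ ψs) = go φ ψs
  where
  go : ∀ {n} → EL n → List (EL n) → EL n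
  go φ []       = φ
  go φ (ψ ∷ ψs) = and φ (go ψ ψs)

-- the formula ⋀_{i ∈ G} K_i φ_i  of L_EL^G (agents in increasing order)
conjG : ∀ {n} → Subset n → (Agent n → EL n) → EL n
conjG {n} G φs = ⋀ (map (λ i → K i (φs i)) (filter (λ i → T? (lookup G i)) (allFin n)))

cplx : ∀ {n} → PAL n → ℕ
cplx (atom p)  = 1
cplx (neg φ)   = suc (cplx φ)
cplx (and φ ψ) = suc (cplx φ ⊔ cplx ψ)
cplx (K a φ)   = suc (cplx φ)
cplx (ann φ ψ) = (4 + cplx φ) * cplx ψ

-- the defining clauses of t, with fuel; each clause strictly decreases
-- cplx, so the fuel (cplx φ) is never exhausted.
tF : ∀ {n} → ℕ → PAL n → EL n
tF zero    _                     = ⊤EL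
tF (suc k) (atom p)              = atom p
tF (suc k) (neg φ)               = neg (tF k φ)
tF (suc k) (and φ ψ)             = and (tF k φ) (tF k ψ)
tF (suc k) (K a φ)               = K a (tF k φ)
tF (suc k) (ann φ (atom p))      = tF k (φ ⇒P atom p)
tF (suc k) (ann φ (neg ψ))       = tF k (φ ⇒P neg (ann φ ψ))
tF (suc k) (ann φ (and ψ χ))     = tF k (and (ann φ ψ) (ann φ χ))
tF (suc k) (ann φ (K a ψ))       = tF k (φ ⇒P K a (ann φ ψ))
tF (suc k) (ann φ (ann ψ χ))     = tF k (ann (and φ (ann φ ψ)) χ)

t : ∀ {n} → PAL n → EL n
t φ = tF (cplx φ) φ

record Model (n : ℕ) : Set₁ where
  field
    W     : Set
    point : W                           -- W ≠ ∅
    R     : Agent n → W → W → Set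
    equiv : ∀ a → IsEquivalence (R a)
    V     : Prop → W → Bool
open Model public

restrict : ∀ {n} (M : Model n) (P : W M → Set) (w : W M) → P w → Model n
restrict M P w pw = record
  { W     = Σ (W M) P
  ; point = w , pw
  ; R     = λ a u v → R M a (Σ.proj₁ u) (Σ.proj₁ v)
  ; equiv = λ a → record
      { refl  = IsEquivalence.refl (equiv M a)
      ; sym   = IsEquivalence.sym (equiv M a)
      ; trans = IsEquivalence.trans (equiv M a)
      }
  ; V     = λ p u → V M p (Σ.proj₁ u)
  }

satEL : ∀ {n} (M : Model n) → W M → EL n → Set
satEL M w (atom p)  = T (V M p w)
satEL M w (neg φ)   = ¬ satEL M w φ
satEL M w (and φ ψ) = satEL M w φ × satEL M w ψ
satEL M w (K a φ)   = ∀ v → R M a w v → satEL M v φ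

sat : ∀ {n} (M : Model n) → W M → Form n → Set
sat M w (atom p)   = T (V M p w)
sat M w (neg φ)    = ¬ sat M w φ
sat M w (and φ ψ)  = sat M w φ × sat M w ψ
sat M w (K a φ)    = ∀ v → R M a w v → sat M v φ
sat M w (ann φ ψ)  =
  (h : sat M w φ) → sat (restrict M (λ v → sat M v φ) w h) (w , h) ψ
sat M w (grp G φ)  = (ψs : Agent _ → EL _) →
  (h : satEL M w (conjG G ψs)) →
  sat (restrict M (λ v → satEL M v (conjG G ψs)) w h) (w , h) φ
-- [⟨G⟩]φ : for all ψ ∈ L_EL^G there is χ ∈ L_EL^{A∖G} with
-- (M,w) ⊨ ψ → ¬[ψ∧χ]¬φ   (existential read classically as ¬∀¬)
sat M w (coal G φ) = (ψs : Agent _ → EL _) → ¬ ((χs : Agent _ → EL _) → ¬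
  (satEL M w (conjG G ψs) →
    ¬ ((h : satEL M w (and (conjG G ψs) (conjG (∁ G) χs))) →
       ¬ sat (restrict M (λ v → satEL M v (and (conjG G ψs) (conjG (∁ G) χs))) w h)
             (w , h) φ)))

Valid : ∀ {n} → Form n → Set₁
Valid {n} φ = (M : Model n) (w : W M) → sat M w φ

-- Every formula of CoGAL, including [G] and [⟨G⟩], is invariant under bisimulation, and the
-- semantics is ¬¬-stable, so the PAL reduction axioms hold and t([ψ]χ) is true exactly where
-- [ψ]χ is. Hence at a ψ-world, K_a t([ψ]χ_a) holds in M iff K_a χ_a holds in M restricted to ψ.
-- Announcing ψ ∧ ⋀ K_a t([ψ]χ_a) therefore keeps the same worlds as announcing ψ and then
-- ⋀ K_a χ_a, and the two resulting models are bisimilar via the identity on worlds.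
module Submission where

open import Defs
open import Data.Nat using (ℕ)
open import Data.List.NonEmpty using (List⁺; map)

open import Data.Nat using (suc; _+_; _*_; _⊔_; _≤_; s≤s; z≤n)
open import Data.Nat.Properties
  using ( ≤-refl; ≤-trans; m≤n⇒m≤1+n; m≤n+m; m+n≤o⇒m≤o; m+n≤o⇒n≤o; m≤m⊔n; m≤n⊔m
        ; m⊔n≤o⇒m≤o; m⊔n≤o⇒n≤o; *-suc; *-monoʳ-≤; m≤n*m )
open import Data.Bool using (T)
open import Data.Fin.Subset using (∁)
open import Data.List using ([]; _∷_)
open import Data.List.NonEmpty using (_∷_)
open import Data.Product using (Σ; ∃-syntax; _×_; _,_; proj₁; proj₂)
open import Data.Product.Function.NonDependent.Propositional using (_×-⇔_)
open import Function.Base using (flip; _∘_)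
open import Function.Bundles using (_⇔_; mk⇔; Equivalence)
open import Function.Construct.Identity using (⇔-id)
import Function.Properties.Equivalence as ⇔
open import Function.Related.TypeIsomorphisms using (→-cong-⇔; ¬-cong-⇔)
open import Relation.Nullary.Negation using (Stable; negated-stable)
open import Relation.Nullary.Decidable.Core using (T?; decidable-stable)
open import Relation.Binary.PropositionalEquality using (_≡_; refl; sym; subst; cong; cong₂)

open Equivalence using (to; from)

private variable
  n : ℕ
  M N : Model n

∀-cong-⇔ : {A : Set} {P Q : A → Set} → (∀ x → P x ⇔ Q x) → (∀ x → P x) ⇔ (∀ x → Q x)
∀-cong-⇔ P⇔Q = mk⇔ (λ f x → to (P⇔Q x) (f x)) (λ g x → from (P⇔Q x) (g x))

record Bisim (M N : Model n) (Z : W M → W N → Set) : Set where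
  field
    atoms : ∀ {u v} → Z u v → ∀ p → V M p u ≡ V N p v
    forth : ∀ {a u v u′} → Z u v → R M a u u′ → Σ (W N) λ v′ → R N a v v′ × Z u′ v′
    back  : ∀ {a u v v′} → Z u v → R N a v v′ → Σ (W M) λ u′ → R M a u u′ × Z u′ v′
open Bisim

Bisim-refl : Bisim M M _≡_
atoms Bisim-refl refl p = refl
forth Bisim-refl {u′ = u′} refl r = u′ , r , refl
back  Bisim-refl {v′ = v′} refl r = v′ , r , refl

Bisim-sym : ∀ {Z} → Bisim M N Z → Bisim N M (flip Z)
atoms (Bisim-sym B) z p = sym (atoms B z p)
forth (Bisim-sym B) z r = back B z r
back  (Bisim-sym B) z r = forth B z r

restrict-Bisim : ∀ {Z} → Bisim M N Z → {P : W M → Set} {Q : W N → Set} →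
  (∀ {u v} → Z u v → P u → Q v) → (∀ {u v} → Z u v → Q v → P u) →
  ∀ {u v} {p : P u} {q : Q v} →
  Bisim (restrict M P u p) (restrict N Q v q) (λ x y → Z (proj₁ x) (proj₁ y))
atoms (restrict-Bisim B P⇒Q Q⇒P) z p = atoms B z p
forth (restrict-Bisim B P⇒Q Q⇒P) {u′ = u′ , pu′} z r =
  let v′ , r′ , z′ = forth B z r in (v′ , P⇒Q z′ pu′) , r′ , z′
back  (restrict-Bisim B P⇒Q Q⇒P) {v′ = v′ , qv′} z r =
  let u′ , r′ , z′ = back B z r in (u′ , Q⇒P z′ qv′) , r′ , z′

satEL-resp : ∀ {Z} → Bisim M N Z → ∀ {u v} → Z u v → ∀ e → satEL M u e → satEL N v e
satEL-resp B z (atom p)  = subst T (atoms B z p)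
satEL-resp B z (neg e)   = λ ¬s s → ¬s (satEL-resp (Bisim-sym B) z e s)
satEL-resp B z (and e f) = λ (s , s′) → satEL-resp B z e s , satEL-resp B z f s′
satEL-resp B z (K a e)   = λ s v′ r → let u′ , r′ , z′ = back B z r in satEL-resp B z′ e (s u′ r′)

restrict-Bisim-EL : ∀ {Z} → Bisim M N Z → ∀ e {u v p q} →
  Bisim (restrict M (λ x → satEL M x e) u p) (restrict N (λ y → satEL N y e) v q)
        (λ x y → Z (proj₁ x) (proj₁ y))
restrict-Bisim-EL B e = restrict-Bisim B (λ z → satEL-resp B z e) (λ z → satEL-resp (Bisim-sym B) z e)

sat-resp : ∀ {Z} → Bisim M N Z → ∀ {u v} → Z u v → ∀ φ → sat M u φ → sat N v φ
sat-resp B z (atom p)   = subst T (atoms B z p)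
sat-resp B z (neg φ)    = λ ¬s s → ¬s (sat-resp (Bisim-sym B) z φ s)
sat-resp B z (and φ ψ)  = λ (s , s′) → sat-resp B z φ s , sat-resp B z ψ s′
sat-resp B z (K a φ)    = λ s v′ r → let u′ , r′ , z′ = back B z r in sat-resp B z′ φ (s u′ r′)
sat-resp B z (ann φ ψ)  = λ s h →
  let B↾ = restrict-Bisim B (λ z′ → sat-resp B z′ φ) (λ z′ → sat-resp (Bisim-sym B) z′ φ)
  in sat-resp B↾ z ψ (s (sat-resp (Bisim-sym B) z φ h))
sat-resp B z (grp G φ)  = λ s ψs h →
  sat-resp (restrict-Bisim-EL B (conjG G ψs)) z φ (s ψs (satEL-resp (Bisim-sym B) z (conjG G ψs) h))
sat-resp B z (coal G φ) = λ s ψs ¬χs → s ψs λ χs ¬inM → ¬χs χs λ gN allN →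
  let E = and (conjG G ψs) (conjG (∁ G) χs) in
  ¬inM (satEL-resp (Bisim-sym B) z (conjG G ψs) gN) λ hM sM →
    allN (satEL-resp B z E hM) (sat-resp (restrict-Bisim-EL B E) z φ sM)

sat-restrict-irrelevant : ∀ {P : W M → Set} {w w′ v} {h : P w} {h′ : P w′} {p p′ : P v} φ →
  sat (restrict M P w h) (v , p) φ → sat (restrict M P w′ h′) (v , p′) φ
sat-restrict-irrelevant {M = M} {P = P} φ =
  sat-resp (restrict-Bisim (Bisim-refl {M = M}) {P = P} {Q = P} (λ { refl x → x }) (λ { refl x → x }))
    refl φ

sat-stable : ∀ (M : Model n) w φ → Stable (sat M w φ)
sat-stable M w (atom p)   = decidable-stable (T? _)
sat-stable M w (neg φ)    = negated-stable
sat-stable M w (and φ ψ)  = λ ¬¬s →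
  sat-stable M w φ (λ ¬s → ¬¬s (¬s ∘ proj₁)) , sat-stable M w ψ (λ ¬s → ¬¬s (¬s ∘ proj₂))
sat-stable M w (K a φ)    = λ ¬¬s v r → sat-stable M v φ (λ ¬s → ¬¬s (λ s → ¬s (s v r)))
sat-stable M w (ann φ ψ)  = λ ¬¬s h → sat-stable _ (w , h) ψ (λ ¬s → ¬¬s (λ s → ¬s (s h)))
sat-stable M w (grp G φ)  = λ ¬¬s ψs h → sat-stable _ (w , h) φ (λ ¬s → ¬¬s (λ s → ¬s (s ψs h)))
sat-stable M w (coal G φ) = λ ¬¬s ψs → negated-stable (λ ¬s → ¬¬s (λ s → ¬s (s ψs)))

sat-elToForm : ∀ (M : Model n) w e → sat M w (elToForm e) ⇔ satEL M w e
sat-elToForm M w (atom p)  = ⇔-id _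
sat-elToForm M w (neg e)   = ¬-cong-⇔ (sat-elToForm M w e)
sat-elToForm M w (and e f) = sat-elToForm M w e ×-⇔ sat-elToForm M w f
sat-elToForm M w (K a e)   = ∀-cong-⇔ λ v → →-cong-⇔ (⇔-id _) (sat-elToForm M v e)

sat-⇒F : ∀ (M : Model n) w φ ψ → sat M w (φ ⇒F ψ) ⇔ (sat M w φ → sat M w ψ)
sat-⇒F M w φ ψ = mk⇔ (λ s h → sat-stable M w ψ (λ ¬t → s (h , ¬t))) (λ f (h , ¬t) → ¬t (f h))

⇒F-congʳ : ∀ (M : Model n) w φ ψ ψ′ →
  sat M w ψ ⇔ sat M w ψ′ → sat M w (φ ⇒F ψ) ⇔ sat M w (φ ⇒F ψ′)
⇒F-congʳ M w φ ψ ψ′ ψ⇔ψ′ = ¬-cong-⇔ (⇔-id (sat M w φ) ×-⇔ ¬-cong-⇔ ψ⇔ψ′)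

sat-⇔F : ∀ (M : Model n) w φ ψ → sat M w φ ⇔ sat M w ψ → sat M w (φ ⇔F ψ)
sat-⇔F M w φ ψ φ⇔ψ = (λ (s , ¬t) → ¬t (to φ⇔ψ s)) , (λ (t , ¬s) → ¬s (from φ⇔ψ t))

ann⇔restrict : ∀ (M : Model n) {w v} φ ψ {h₀ : sat M w φ} (h : sat M v φ) →
  sat M v (ann φ ψ) ⇔ sat (restrict M (λ u → sat M u φ) w h₀) (v , h) ψ
ann⇔restrict M φ ψ {h₀} h = mk⇔
  (λ s → sat-restrict-irrelevant {M = M} {P = P} {h′ = h₀} ψ (s h))
  (λ s h′ → sat-restrict-irrelevant {M = M} {P = P} {h = h₀} {p′ = h′} ψ s)
  where
  P : W M → Set
  P u = sat M u φ

K-ann⇔K-restrict : ∀ (M : Model n) {w v} a φ ψ {h₀ : sat M w φ} (h : sat M v φ) →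
  sat M v (K a (ann φ ψ)) ⇔ sat (restrict M (λ u → sat M u φ) w h₀) (v , h) (K a ψ)
K-ann⇔K-restrict M a φ ψ h = mk⇔
  (λ s (u , hu) r → to (ann⇔restrict M φ ψ hu) (s u r))
  (λ s u r hu → from (ann⇔restrict M φ ψ hu) (s (u , hu) r) hu)

ann-atom : ∀ (M : Model n) w φ p → sat M w (ann φ (atom p)) ⇔ sat M w (φ ⇒F atom p)
ann-atom M w φ p = ⇔.sym (sat-⇒F M w φ (atom p))

ann-neg : ∀ (M : Model n) w φ ψ → sat M w (ann φ (neg ψ)) ⇔ sat M w (φ ⇒F neg (ann φ ψ))
ann-neg M w φ ψ = ⇔.trans
  (∀-cong-⇔ λ h → ¬-cong-⇔ (⇔.sym (ann⇔restrict M φ ψ h)))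
  (⇔.sym (sat-⇒F M w φ (neg (ann φ ψ))))

ann-and : ∀ (M : Model n) w φ ψ χ → sat M w (ann φ (and ψ χ)) ⇔ sat M w (and (ann φ ψ) (ann φ χ))
ann-and M w φ ψ χ = mk⇔ (λ s → proj₁ ∘ s , proj₂ ∘ s) (λ (s , s′) h → s h , s′ h)

ann-K : ∀ (M : Model n) w a φ ψ → sat M w (ann φ (K a ψ)) ⇔ sat M w (φ ⇒F K a (ann φ ψ))
ann-K M w a φ ψ = ⇔.trans
  (∀-cong-⇔ λ h → ⇔.sym (K-ann⇔K-restrict M a φ ψ h))
  (⇔.sym (sat-⇒F M w φ (K a (ann φ ψ))))

infixr 5 t[_]_
t[_]_ : EL n → EL n → EL n
t[ ψ ] atom p      = neg (and ψ (neg (atom p)))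
t[ ψ ] neg χ       = neg (and ψ (neg (neg (t[ ψ ] χ))))
t[ ψ ] and χ₁ χ₂   = and (t[ ψ ] χ₁) (t[ ψ ] χ₂)
t[ ψ ] K a χ       = neg (and ψ (neg (K a (t[ ψ ] χ))))

sat-t[] : ∀ (M : Model n) w ψ χ →
  sat M w (elToForm (t[ ψ ] χ)) ⇔ sat M w (ann (elToForm ψ) (elToForm χ))
sat-t[] M w ψ (atom p)    = ⇔.sym (ann-atom M w (elToForm ψ) p)
sat-t[] M w ψ (neg χ)     = ⇔.trans
  (⇒F-congʳ M w (elToForm ψ) (neg (elToForm (t[ ψ ] χ))) (neg (ann (elToForm ψ) (elToForm χ)))
    (¬-cong-⇔ (sat-t[] M w ψ χ)))
  (⇔.sym (ann-neg M w (elToForm ψ) (elToForm χ)))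
sat-t[] M w ψ (and χ₁ χ₂) = ⇔.trans
  (sat-t[] M w ψ χ₁ ×-⇔ sat-t[] M w ψ χ₂)
  (⇔.sym (ann-and M w (elToForm ψ) (elToForm χ₁) (elToForm χ₂)))
sat-t[] M w ψ (K a χ)     = ⇔.trans
  (⇒F-congʳ M w (elToForm ψ) (K a (elToForm (t[ ψ ] χ))) (K a (ann (elToForm ψ) (elToForm χ)))
    (∀-cong-⇔ λ v → →-cong-⇔ (⇔-id _) (sat-t[] M v ψ χ)))
  (⇔.sym (ann-K M w a (elToForm ψ) (elToForm χ)))

cplx-pos : ∀ (φ : PAL n) → 1 ≤ cplx φ
cplx-pos (atom p)  = s≤s z≤n
cplx-pos (neg φ)   = s≤s z≤n
cplx-pos (and φ ψ) = s≤s z≤n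
cplx-pos (K a φ)   = s≤s z≤n
cplx-pos (ann φ ψ) = ≤-trans (cplx-pos ψ) (m≤n*m (cplx ψ) (4 + cplx φ))

-- Unfolding t on [ψ]¬χ or [ψ]K_a χ down to the recursive call t([ψ]χ) takes five steps of fuel.
fuel-ann : ∀ c d {k} → 1 ≤ c → (4 + c) * suc d ≤ k →
  ∃[ k′ ] (k ≡ 5 + k′ × c ≤ 2 + k′ × (4 + c) * d ≤ k′)
fuel-ann (suc c) d {k} (s≤s z≤n) le with subst (_≤ k) (*-suc (5 + c) d) le
... | s≤s (s≤s (s≤s (s≤s (s≤s le′)))) =
  _ , refl , m≤n⇒m≤1+n (s≤s (m+n≤o⇒m≤o c le′)) , m+n≤o⇒n≤o c le′

tF-elToPAL : ∀ (e : EL n) {k} → cplx (elToPAL e) ≤ k → tF k (elToPAL e) ≡ e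
tF-elToPAL (atom p)  (s≤s _) = refl
tF-elToPAL (neg e)   (s≤s le) = cong neg (tF-elToPAL e le)
tF-elToPAL (and e f) (s≤s le) =
  cong₂ and (tF-elToPAL e (m⊔n≤o⇒m≤o _ _ le)) (tF-elToPAL f (m⊔n≤o⇒n≤o _ _ le))
tF-elToPAL (K a e)   (s≤s le) = cong (K a) (tF-elToPAL e le)

tF-ann : ∀ (ψ χ : EL n) {k} →
  cplx (ann (elToPAL ψ) (elToPAL χ)) ≤ k → tF k (ann (elToPAL ψ) (elToPAL χ)) ≡ t[ ψ ] χ
tF-ann ψ (atom p) le with fuel-ann (cplx (elToPAL ψ)) 0 (cplx-pos (elToPAL ψ)) le
... | _ , refl , ψ≤ , _ = cong (λ ψ′ → neg (and ψ′ (neg (atom p)))) (tF-elToPAL ψ ψ≤)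
tF-ann ψ (neg χ) le with fuel-ann (cplx (elToPAL ψ)) (cplx (elToPAL χ)) (cplx-pos (elToPAL ψ)) le
... | _ , refl , ψ≤ , χ≤ =
  cong₂ (λ ψ′ χ′ → neg (and ψ′ (neg (neg χ′)))) (tF-elToPAL ψ ψ≤) (tF-ann ψ χ χ≤)
tF-ann ψ (K a χ) le with fuel-ann (cplx (elToPAL ψ)) (cplx (elToPAL χ)) (cplx-pos (elToPAL ψ)) le
... | _ , refl , ψ≤ , χ≤ =
  cong₂ (λ ψ′ χ′ → neg (and ψ′ (neg (K a χ′)))) (tF-elToPAL ψ ψ≤) (tF-ann ψ χ χ≤)
tF-ann ψ (and χ₁ χ₂) le
  with fuel-ann (cplx (elToPAL ψ)) (cplx (elToPAL χ₁) ⊔ cplx (elToPAL χ₂)) (cplx-pos (elToPAL ψ)) le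
... | k′ , refl , _ , χ≤ =
  cong₂ and (tF-ann ψ χ₁ (bound (m≤m⊔n d₁ d₂))) (tF-ann ψ χ₂ (bound (m≤n⊔m d₁ d₂)))
  where
  d₁ d₂ : ℕ
  d₁ = cplx (elToPAL χ₁)
  d₂ = cplx (elToPAL χ₂)
  bound : ∀ {d} → d ≤ d₁ ⊔ d₂ → (4 + cplx (elToPAL ψ)) * d ≤ 3 + k′
  bound d≤ = ≤-trans (*-monoʳ-≤ (4 + cplx (elToPAL ψ)) d≤) (≤-trans χ≤ (m≤n+m k′ 3))

satEL-t-ann : ∀ (M : Model n) w ψ χ →
  satEL M w (t (ann (elToPAL ψ) (elToPAL χ))) ⇔ sat M w (ann (elToForm ψ) (elToForm χ))
satEL-t-ann M w ψ χ =
  subst (λ e → satEL M w e ⇔ sat M w (ann (elToForm ψ) (elToForm χ))) (sym (tF-ann ψ χ ≤-refl))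
    (⇔.trans (⇔.sym (sat-elToForm M w (t[ ψ ] χ))) (sat-t[] M w ψ χ))

satEL-⋀⁺-cong : ∀ {A : Set} {u v} (f g : A → EL n) (as : List⁺ A) →
  (∀ a → satEL M u (f a) ⇔ satEL N v (g a)) →
  satEL M u (⋀⁺ (map f as)) ⇔ satEL N v (⋀⁺ (map g as))
satEL-⋀⁺-cong {M = M} {N = N} {u = u} {v} f g (a ∷ as) f⇔g = go a as
  where
  go : ∀ a as → satEL M u (⋀⁺ (map f (a ∷ as))) ⇔ satEL N v (⋀⁺ (map g (a ∷ as)))
  go a []       = f⇔g a
  go a (b ∷ bs) = f⇔g a ×-⇔ go b bs

restrict-restrict : ∀ {P S : W M → Set} {Q : Σ (W M) P → Set} →
  (∀ v → S v ⇔ Σ (P v) λ p → Q (v , p)) → ∀ {w s w₀ p₀ u q} →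
  Bisim (restrict M S w s) (restrict (restrict M P w₀ p₀) Q u q) (λ x y → proj₁ x ≡ proj₁ (proj₁ y))
atoms (restrict-restrict {M = M} S⇔PQ) z p = cong (V M p) z
forth (restrict-restrict {M = M} S⇔PQ) {a} {u′ = x′ , s′} z r =
  let p′ , q′ = to (S⇔PQ x′) s′ in ((x′ , p′) , q′) , subst (λ x → R M a x x′) z r , refl
back  (restrict-restrict {M = M} S⇔PQ) {a} {v′ = (x′ , p′) , q′} z r =
  (x′ , from (S⇔PQ x′) (p′ , q′)) , subst (λ x → R M a x x′) (sym z) r , refl

ann-and⇔ann-ann : ∀ (M : Model n) w φ χ χ′ θ →
  (∀ {w₀ h₀} v p → sat M v χ ⇔ sat (restrict M (λ u → sat M u φ) w₀ h₀) (v , p) χ′) →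
  sat M w (ann (and φ χ) θ) ⇔ sat M w (ann φ (ann χ′ θ))
ann-and⇔ann-ann M w φ χ χ′ θ χ⇔χ′ = mk⇔
  (λ s h c′ → let c = from (χ⇔χ′ w h) c′ in
     sat-resp (relativise (h , c) h c′) refl θ (s (h , c)))
  (λ s (h , c) → let c′ = to (χ⇔χ′ w h) c in
     sat-resp (Bisim-sym (relativise (h , c) h c′)) refl θ (s h c′))
  where
  M↾φ : sat M w φ → Model _
  M↾φ = restrict M (λ u → sat M u φ) w

  relativise : ∀ hc h c′ → Bisim (restrict M (λ u → sat M u (and φ χ)) w hc)
    (restrict (M↾φ h) (λ y → sat (M↾φ h) y χ′) (w , h) c′) (λ x y → proj₁ x ≡ proj₁ (proj₁ y))
  relativise hc h c′ = restrict-restrict {M = M}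
    (λ v → mk⇔ (λ (p , c) → p , to (χ⇔χ′ v p) c) (λ (p , c′) → p , from (χ⇔χ′ v p) c′))
    {w} {hc} {w} {h} {w , h} {c′}

K-t-ann⇔K-restrict : ∀ (M : Model n) {w v} a (ψ χ : EL n)
  {h₀ : sat M w (elToForm ψ)} (h : sat M v (elToForm ψ)) →
  satEL M v (K a (t (ann (elToPAL ψ) (elToPAL χ))))
    ⇔ satEL (restrict M (λ u → sat M u (elToForm ψ)) w h₀) (v , h) (K a χ)
K-t-ann⇔K-restrict M {v = v} a ψ χ h = ⇔.trans
  (∀-cong-⇔ λ u → →-cong-⇔ (⇔-id _) (satEL-t-ann M u ψ χ))
  (⇔.trans (K-ann⇔K-restrict M a (elToForm ψ) (elToForm χ) h) (sat-elToForm _ (v , h) (K a χ)))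

lemma1 : (n : ℕ) (as : List⁺ (Agent n)) (ψ : EL n) (χ : Agent n → EL n) (φ : Form n) →
    Valid
      (ann (elToForm (and ψ (⋀⁺ (map (λ a → K a (t (ann (elToPAL ψ) (elToPAL (χ a))))) as)))) φ
        ⇔F ann (elToForm ψ) (ann (elToForm (⋀⁺ (map (λ a → K a (χ a)) as))) φ))
lemma1 n as ψ χ φ M w =
  sat-⇔F M w (ann (and ψ̂ (elToForm knowledge)) φ) (ann ψ̂ (ann (elToForm knowledge′) φ))
    (ann-and⇔ann-ann M w ψ̂ (elToForm knowledge) (elToForm knowledge′) φ knowledge⇔knowledge′)
  where
  ψ̂ : Form n
  ψ̂ = elToForm ψ
  knowledge knowledge′ : EL n
  knowledge  = ⋀⁺ (map (λ a → K a (t (ann (elToPAL ψ) (elToPAL (χ a))))) as)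
  knowledge′ = ⋀⁺ (map (λ a → K a (χ a)) as)
  knowledge⇔knowledge′ : ∀ {w₀ h₀} v h → sat M v (elToForm knowledge)
    ⇔ sat (restrict M (λ u → sat M u ψ̂) w₀ h₀) (v , h) (elToForm knowledge′)
  knowledge⇔knowledge′ v h = ⇔.trans (sat-elToForm M v knowledge) (⇔.trans
    (satEL-⋀⁺-cong _ _ as λ a → K-t-ann⇔K-restrict M a ψ (χ a) h)
    (⇔.sym (sat-elToForm _ (v , h) knowledge′)))
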